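{- Let $G$ be a connected graph of order $n\geq 2$ and $\overline{G}$ its complement. Then $2\leq F_{xt}(G)+F_{xt}(\overline{G})\leq 2n$. Both bounds are sharp.
   Context: All graphs are finite and simple. A fixing set of a graph $H$ is a set $F\subseteq V(H)$ such that the only automorphism of $H$ fixing every vertex of $F$ is the identity. A fixatic partition of $H$ is a partition of $V(H)$ into classes each of which is a fixing set of $H$; the fixatic number $F_{xt}(H)$ is the maximum number of classes in a fixatic partition. -}

module Defs where

open import Data.Nat using (ℕ)
open import Data.Bool using (Bool; true; false; not; if_then_else_)
open import Data.Fin using (Fin; _≟_)
open import Data.Fin.Permutation using (Permutation′; _⟨$⟩ʳ_)
open import Data.Product using (Σ; ∃; _×_)
open import Relation.Nullary using (does)
open import Relation.Binary.PropositionalEquality using (_≡_)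

record Graph (n : ℕ) : Set where
  field
    adj     : Fin n → Fin n → Bool
    adj-sym : ∀ u v → adj u v ≡ adj v u
    adj-irr : ∀ v → adj v v ≡ false
open Graph public

complement : ∀ {n} → Graph n → Graph n
complement {n} G = record
  { adj     = cadj
  ; adj-sym = csym
  ; adj-irr = cirr
  }
  where
  cadj : Fin n → Fin n → Bool
  cadj u v = if does (u ≟ v) then false else not (adj G u v)
  csym : ∀ u v → cadj u v ≡ cadj v u
  csym u v with u ≟ v | v ≟ u
  ... | Relation.Nullary.yes _ | Relation.Nullary.yes _ = Relation.Binary.PropositionalEquality.refl
  ... | Relation.Nullary.yes p | Relation.Nullary.no q = Data.Empty.⊥-elim (q (Relation.Binary.PropositionalEquality.sym p))
    where import Data.Empty
  ... | Relation.Nullary.no p | Relation.Nullary.yes q = Data.Empty.⊥-elim (p (Relation.Binary.PropositionalEquality.sym q))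
    where import Data.Empty
  ... | Relation.Nullary.no _ | Relation.Nullary.no _ =
    Relation.Binary.PropositionalEquality.cong not (adj-sym G u v)
  cirr : ∀ v → cadj v v ≡ false
  cirr v with v ≟ v
  ... | Relation.Nullary.yes _ = Relation.Binary.PropositionalEquality.refl
  ... | Relation.Nullary.no ¬p = Data.Empty.⊥-elim (¬p Relation.Binary.PropositionalEquality.refl)
    where import Data.Empty

data Walk {n : ℕ} (G : Graph n) : Fin n → Fin n → Set where
  here : ∀ {v} → Walk G v v
  step : ∀ {u w v} → adj G u w ≡ true → Walk G w v → Walk G u v

Connected : ∀ {n} → Graph n → Set
Connected {n} G = ∀ (u v : Fin n) → Walk G u v

IsAutomorphism : ∀ {n} → Graph n → Permutation′ n → Set
IsAutomorphism {n} G σ = ∀ (u v : Fin n) → adj G (σ ⟨$⟩ʳ u) (σ ⟨$⟩ʳ v) ≡ adj G u v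

IsFixingSet : ∀ {n} → Graph n → (Fin n → Set) → Set
IsFixingSet {n} G F =
  ∀ (σ : Permutation′ n) → IsAutomorphism G σ →
  (∀ v → F v → σ ⟨$⟩ʳ v ≡ v) → ∀ v → σ ⟨$⟩ʳ v ≡ v

-- A partition of V(G) into k (nonempty) classes, given by a surjective
-- class map c : Fin n → Fin k, is fixatic if every class is a fixing set.
IsFixaticPartition : ∀ {n k} → Graph n → (Fin n → Fin k) → Set
IsFixaticPartition {n} {k} G c =
  (∀ (i : Fin k) → ∃ λ v → c v ≡ i) ×
  (∀ (i : Fin k) → IsFixingSet G (λ v → c v ≡ i))

IsFixaticNumber : ∀ {n} → Graph n → ℕ → Set
IsFixaticNumber {n} G m =
  (Σ (Fin n → Fin m) λ c → IsFixaticPartition G c) ×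
  (∀ (k : ℕ) (c : Fin n → Fin k) → IsFixaticPartition G c → k Data.Nat.≤ m)
  where import Data.Nat

module Submission where

-- The one-class partition is fixatic and a fixatic
--     partition into k classes is a surjection onto Fin k, so
--     1 ≤ k ≤ n.  Constructively the maximum F_xt(G) must be found by
--     a search, so we first show that "G has a fixatic partition into
--     k classes" is decidable: functions between finite sets are coded
--     by elements of Fin (k ^ n), and permutations by pairs of mutually
--     inverse functions.  Moreover G and its complement have the same
--     automorphisms, hence the same fixing sets and F_xt(G) = F_xt(Ḡ);
--     thus 2 ≤ F_xt(G) + F_xt(Ḡ) = 2 F_xt(G) ≤ 2n.  If every permutation of at least
--     three vertices is an automorphism (as for K₃), a fixing set omits
--     at most one vertex (use a transposition); by pigeonhole two
--     classes cannot both be fixing, so F_xt(K₃) = F_xt(K̄₃) = 1.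
-- (3) Sharpness of the upper bound.  On two vertices a permutation
--     fixing one vertex fixes the other, so F_xt(K₂) = F_xt(K̄₂) = 2.

open import Defs
open import Data.Nat using (ℕ; zero; suc; _+_; _*_; _≤_; z≤n; s≤s)
open import Data.Nat.Properties using (≤-refl; ≤-pred; ≤∧≢⇒<; n≤0⇒n≡0; +-mono-≤; +-identityʳ)
open import Data.Bool using (false; not; if_then_else_)
import Data.Bool.Properties as Bool
open import Data.Fin using (Fin; _≟_; _↑ˡ_; finToFun; funToFin)
open import Data.Fin.Properties
  using (all?; any?; pigeonhole; injective⇒≤; finToFun-funToFin; <⇒≢; 0≢1+n)
open import Data.Fin.Permutation
  using (Permutation′; _⟨$⟩ʳ_; _⟨$⟩ˡ_; _≈_; permutation; transpose; inverseˡ; inverseʳ)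
open import Data.Product using (Σ; ∃; _×_; _,_; proj₁; proj₂)
open import Function using (_∘_)
open import Function.Bundles using (Injection; mk⇔)
open import Function.Properties.Inverse using (↔⇒↣)
open import Relation.Nullary using (Dec; yes; no; ¬_; does; contradiction)
open import Relation.Nullary.Decidable using (_×-dec_; _→-dec_; map′; dec-true; dec-false; does-⇔)
open import Relation.Binary.PropositionalEquality
  using (_≡_; _≢_; refl; sym; trans; cong; cong₂; subst; module ≡-Reasoning)

Extensional : ∀ {m k} → ((Fin m → Fin k) → Set) → Set
Extensional P = ∀ {f g} → (∀ x → f x ≡ g x) → P f → P g

anyFunction? : ∀ {m k} {P : (Fin m → Fin k) → Set} →
               Extensional P → (∀ f → Dec (P f)) → Dec (∃ P)
anyFunction? ext P? =
  map′ (λ (i , p) → finToFun i , p)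
       (λ (f , p) → funToFin f , ext (λ x → sym (finToFun-funToFin f x)) p)
       (any? (P? ∘ finToFun))

PermutationInvariant : ∀ {n} → (Permutation′ n → Set) → Set
PermutationInvariant P = ∀ σ τ → σ ≈ τ → P σ → P τ

-- Universal statements about permutations are decidable: a permutation
-- is a pair of mutually inverse maps, each coded by an element of
-- Fin (n ^ n).
allPermutations? : ∀ {n} {P : Permutation′ n → Set} →
                   PermutationInvariant P → (∀ σ → Dec (P σ)) → Dec (∀ σ → P σ)
allPermutations? {n} {P} inv P? =
  map′ fromCodes (λ h _ _ _ _ → h _)
       (all? λ i → all? λ j → forInversePair? (finToFun i) (finToFun j))
  where
  ForInversePair : (f g : Fin n → Fin n) → Set
  ForInversePair f g =
    (l : ∀ y → f (g y) ≡ y) (r : ∀ x → g (f x) ≡ x) → P (permutation f g l r)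

  forInversePair? : ∀ f g → Dec (ForInversePair f g)
  forInversePair? f g with all? (λ y → f (g y) ≟ y) | all? (λ x → g (f x) ≟ x)
  ... | yes l | yes r = map′ (λ p _ _ → inv _ _ (λ _ → refl) p) (λ h → h l r)
                             (P? (permutation f g l r))
  ... | no ¬l | _     = yes (λ l → contradiction l ¬l)
  ... | yes _ | no ¬r = yes (λ _ r → contradiction r ¬r)

  fromCodes : (∀ i j → ForInversePair (finToFun i) (finToFun j)) → ∀ σ → P σ
  fromCodes h σ = inv _ σ f≗σʳ (h (funToFin (σ ⟨$⟩ʳ_)) (funToFin (σ ⟨$⟩ˡ_)) l r)
    where
    f g : Fin n → Fin n
    f = finToFun (funToFin (σ ⟨$⟩ʳ_))
    g = finToFun (funToFin (σ ⟨$⟩ˡ_))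
    f≗σʳ : ∀ x → f x ≡ σ ⟨$⟩ʳ x
    f≗σʳ = finToFun-funToFin (σ ⟨$⟩ʳ_)
    g≗σˡ : ∀ y → g y ≡ σ ⟨$⟩ˡ y
    g≗σˡ = finToFun-funToFin (σ ⟨$⟩ˡ_)
    l : ∀ y → f (g y) ≡ y
    l y = trans (f≗σʳ (g y)) (trans (cong (σ ⟨$⟩ʳ_) (g≗σˡ y)) (inverseʳ σ))
    r : ∀ x → g (f x) ≡ x
    r x = trans (g≗σˡ (f x)) (trans (cong (σ ⟨$⟩ˡ_) (f≗σʳ x)) (inverseˡ σ))

module _ {n : ℕ} (G : Graph n) where

  IdentityIfFixes : (Fin n → Set) → Permutation′ n → Set
  IdentityIfFixes F σ =
    IsAutomorphism G σ → (∀ v → F v → σ ⟨$⟩ʳ v ≡ v) → ∀ v → σ ⟨$⟩ʳ v ≡ v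

  identityIfFixes-invariant : (F : Fin n → Set) → PermutationInvariant (IdentityIfFixes F)
  identityIfFixes-invariant F σ τ σ≈τ idσ autτ fixτ v =
    trans (sym (σ≈τ v))
          (idσ (λ u w → trans (cong₂ (adj G) (σ≈τ u) (σ≈τ w)) (autτ u w))
               (λ w Fw → trans (σ≈τ w) (fixτ w Fw)) v)

  isAutomorphism? : ∀ σ → Dec (IsAutomorphism G σ)
  isAutomorphism? σ = all? λ u → all? λ v → adj G (σ ⟨$⟩ʳ u) (σ ⟨$⟩ʳ v) Bool.≟ adj G u v

  isFixingSet? : (F : Fin n → Set) → (∀ v → Dec (F v)) → Dec (IsFixingSet G F)
  isFixingSet? F F? = allPermutations? (identityIfFixes-invariant F) λ σ →
    isAutomorphism? σ →-dec
    (all? (λ v → F? v →-dec (σ ⟨$⟩ʳ v ≟ v)) →-dec all? (λ v → σ ⟨$⟩ʳ v ≟ v))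

  isFixaticPartition? : ∀ {k} (c : Fin n → Fin k) → Dec (IsFixaticPartition G c)
  isFixaticPartition? c =
    (all? λ i → any? λ v → c v ≟ i) ×-dec (all? λ i → isFixingSet? (λ v → c v ≡ i) (λ v → c v ≟ i))

  isFixaticPartition-extensional : ∀ {k} → Extensional (IsFixaticPartition {k = k} G)
  isFixaticPartition-extensional c≗c′ (onto , fixing) =
    (λ i → proj₁ (onto i) , trans (sym (c≗c′ _)) (proj₂ (onto i))) ,
    (λ i σ aut fix → fixing i σ aut (λ v cv≡i → fix v (trans (sym (c≗c′ v)) cv≡i)))

  HasFixaticPartition : ℕ → Set
  HasFixaticPartition k = Σ (Fin n → Fin k) (IsFixaticPartition G)

  hasFixaticPartition? : ∀ k → Dec (HasFixaticPartition k)
  hasFixaticPartition? k =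
    anyFunction? isFixaticPartition-extensional isFixaticPartition?

largest : {P : ℕ → Set} → (∀ k → Dec (P k)) → ∃ P → (b : ℕ) →
          (∀ k → P k → k ≤ b) → Σ ℕ λ m → P m × (∀ k → P k → k ≤ m)
largest {P} P? (k , pk) zero bounded =
  zero , subst P (n≤0⇒n≡0 (bounded k pk)) pk , bounded
largest {P} P? witness (suc b) bounded with P? (suc b)
... | yes p = suc b , p , bounded
... | no ¬p = largest P? witness b λ k pk →
  ≤-pred (≤∧≢⇒< (bounded k pk) (λ k≡1+b → ¬p (subst P k≡1+b pk)))

-- A partition of n vertices has at most n classes: choosing one vertex
-- from each class is injective.
classes≤order : ∀ {n k} (c : Fin n → Fin k) → (∀ i → ∃ λ v → c v ≡ i) → k ≤ n
classes≤order c onto = injective⇒≤ {f = proj₁ ∘ onto} λ {i} {j} same →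
  trans (sym (proj₂ (onto i))) (trans (cong c same) (proj₂ (onto j)))

singleClass : ∀ {n} (G : Graph (suc n)) → HasFixaticPartition G 1
singleClass G =
  (λ _ → Fin.zero) ,
  (λ { Fin.zero → Fin.zero , refl }) ,
  (λ { Fin.zero σ _ fixesAll v → fixesAll v refl })

fixaticNumber : ∀ {n} (G : Graph (suc n)) →
                Σ ℕ λ a → IsFixaticNumber G a × 1 ≤ a × a ≤ suc n
fixaticNumber {n} G
  with largest (hasFixaticPartition? G) (1 , singleClass G) (suc n)
               (λ k (c , fixatic) → classes≤order c (proj₁ fixatic))
... | a , (c , fixatic) , maximal =
  a , ((c , fixatic) , λ k c′ fixatic′ → maximal k (c′ , fixatic′)) ,
  maximal 1 (singleClass G) , classes≤order c (proj₁ fixatic)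

permutation-preserves-≟ : ∀ {n} (σ : Permutation′ n) (u v : Fin n) →
                          does (σ ⟨$⟩ʳ u ≟ σ ⟨$⟩ʳ v) ≡ does (u ≟ v)
permutation-preserves-≟ σ u v =
  does-⇔ (mk⇔ (Injection.injective (↔⇒↣ σ)) (cong (σ ⟨$⟩ʳ_))) (σ ⟨$⟩ʳ u ≟ σ ⟨$⟩ʳ v) (u ≟ v)

automorphism-complement : ∀ {n} (G : Graph n) σ →
                          IsAutomorphism G σ → IsAutomorphism (complement G) σ
automorphism-complement G σ aut u v =
  cong₂ (λ b x → if b then false else not x) (permutation-preserves-≟ σ u v) (aut u v)

complement-involutive : ∀ {n} (G : Graph n) u v →
                        adj (complement (complement G)) u v ≡ adj G u v
complement-involutive G u v with u ≟ v
... | yes refl = sym (adj-irr G u)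
... | no _     = Bool.not-involutive (adj G u v)

automorphism-uncomplement : ∀ {n} (G : Graph n) σ →
                            IsAutomorphism (complement G) σ → IsAutomorphism G σ
automorphism-uncomplement G σ aut u v = begin
  adj G (σ ⟨$⟩ʳ u) (σ ⟨$⟩ʳ v)                     ≡⟨ complement-involutive G _ _ ⟨
  adj (complement (complement G)) (σ ⟨$⟩ʳ u) (σ ⟨$⟩ʳ v)
    ≡⟨ automorphism-complement (complement G) σ aut u v ⟩
  adj (complement (complement G)) u v             ≡⟨ complement-involutive G u v ⟩
  adj G u v                                       ∎
  where open ≡-Reasoning

fixingSet-transfer : ∀ {n} (G H : Graph n) → (∀ σ → IsAutomorphism H σ → IsAutomorphism G σ) →
                     ∀ F → IsFixingSet G F → IsFixingSet H F
fixingSet-transfer G H autH⇒autG F fixing σ autH = fixing σ (autH⇒autG σ autH)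

fixaticPartition-transfer : ∀ {n k} (G H : Graph n) →
                            (∀ σ → IsAutomorphism H σ → IsAutomorphism G σ) →
                            (c : Fin n → Fin k) → IsFixaticPartition G c → IsFixaticPartition H c
fixaticPartition-transfer G H autH⇒autG c (onto , fixing) =
  onto , λ i → fixingSet-transfer G H autH⇒autG _ (fixing i)

fixaticNumber-complement : ∀ {n} (G : Graph n) {a} →
                           IsFixaticNumber G a → IsFixaticNumber (complement G) a
fixaticNumber-complement G ((c , fixatic) , maximal) =
  (c , fixaticPartition-transfer G (complement G) (automorphism-uncomplement G) c fixatic) ,
  λ k c′ fixatic′ →
    maximal k c′ (fixaticPartition-transfer (complement G) G (automorphism-complement G) c′ fixatic′)

complete : ∀ n → Graph n
complete n = record
  { adj     = λ u v → not (does (u ≟ v))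
  ; adj-sym = λ u v → cong not (does-⇔ (mk⇔ sym sym) (u ≟ v) (v ≟ u))
  ; adj-irr = λ v → cong not (dec-true (v ≟ v) refl)
  }

complete-connected : ∀ {n} → Connected (complete n)
complete-connected u v with u ≟ v
... | yes refl = here
... | no u≢v   = step (cong not (dec-false (u ≟ v) u≢v)) here

complete-automorphism : ∀ {n} σ → IsAutomorphism (complete n) σ
complete-automorphism σ u v = cong not (permutation-preserves-≟ σ u v)

transpose-swaps : ∀ {n} (u w : Fin n) → transpose u w ⟨$⟩ʳ u ≡ w
transpose-swaps u w rewrite dec-true (u ≟ u) refl = refl

transpose-fixes : ∀ {n} {u w v : Fin n} → v ≢ u → v ≢ w → transpose u w ⟨$⟩ʳ v ≡ v
transpose-fixes {u = u} {w} {v} v≢u v≢w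
  rewrite dec-false (v ≟ u) v≢u | dec-false (v ≟ w) v≢w = refl

-- If every permutation is an automorphism, a fixing set F omits at most
-- one vertex: the transposition of two omitted vertices fixes F.
fixingSet-omits-at-most-one :
  ∀ {n} (G : Graph n) → (∀ σ → IsAutomorphism G σ) →
  ∀ F → IsFixingSet G F → ∀ {u w} → ¬ F u → ¬ F w → u ≡ w
fixingSet-omits-at-most-one G allAut F fixing {u} {w} ¬Fu ¬Fw =
  trans (sym (fixing (transpose u w) (allAut (transpose u w)) fixesF u)) (transpose-swaps u w)
  where
  fixesF : ∀ v → F v → transpose u w ⟨$⟩ʳ v ≡ v
  fixesF v Fv = transpose-fixes (λ v≡u → ¬Fu (subst F v≡u Fv)) (λ v≡w → ¬Fw (subst F v≡w Fv))

-- On at least three vertices, if every permutation is an automorphism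
-- then no fixatic partition has two classes: each vertex avoids class
-- 0 or class 1, and by pigeonhole two vertices avoid the same class.
fullySymmetric-fixaticNumber : ∀ {n} → 3 ≤ n → (G : Graph n) →
                               (∀ σ → IsAutomorphism G σ) → IsFixaticNumber G 1
fullySymmetric-fixaticNumber {n} 3≤n@(s≤s _) G allAut = singleClass G , atMostOne
  where
  avoidedClass : ∀ {k} (c : Fin n → Fin (suc (suc k))) v → Σ (Fin 2) λ b → c v ≢ b ↑ˡ k
  avoidedClass c v with c v ≟ Fin.zero
  ... | yes cv≡0 = Fin.suc Fin.zero , λ cv≡1 → 0≢1+n (trans (sym cv≡0) cv≡1)
  ... | no cv≢0  = Fin.zero , cv≢0

  noTwoClasses : ∀ {k} (c : Fin n → Fin (suc (suc k))) → ¬ IsFixaticPartition G c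
  noTwoClasses {k} c (_ , fixing)
    with pigeonhole 3≤n (proj₁ ∘ avoidedClass c)
  ... | i , j , i<j , same = <⇒≢ i<j (fixingSet-omits-at-most-one G allAut _
          (fixing (b ↑ˡ k)) i-avoids-b j-avoids-b)
    where
    b : Fin 2
    b = proj₁ (avoidedClass c i)
    i-avoids-b : c i ≢ b ↑ˡ k
    i-avoids-b = proj₂ (avoidedClass c i)
    j-avoids-b : c j ≢ b ↑ˡ k
    j-avoids-b = subst (λ b′ → c j ≢ b′ ↑ˡ k) (sym same) (proj₂ (avoidedClass c j))

  atMostOne : ∀ k (c : Fin n → Fin k) → IsFixaticPartition G c → k ≤ 1
  atMostOne zero          _ _       = z≤n
  atMostOne (suc zero)    _ _       = s≤s z≤n
  atMostOne (suc (suc k)) c fixatic = contradiction fixatic (noTwoClasses c)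

fixesAllButOne⇒fixes : ∀ {n} (σ : Permutation′ n) w →
                        (∀ v → v ≢ w → σ ⟨$⟩ʳ v ≡ v) → σ ⟨$⟩ʳ w ≡ w
fixesAllButOne⇒fixes σ w fixes with σ ⟨$⟩ʳ w ≟ w
... | yes σw≡w = σw≡w
... | no σw≢w  = Injection.injective (↔⇒↣ σ) (fixes (σ ⟨$⟩ʳ w) σw≢w)

twoVertices : (u v i : Fin 2) → u ≢ v → v ≢ i → u ≡ i
twoVertices Fin.zero           Fin.zero           _                  u≢v _   = contradiction refl u≢v
twoVertices (Fin.suc Fin.zero) (Fin.suc Fin.zero) _                  u≢v _   = contradiction refl u≢v
twoVertices _                  Fin.zero           Fin.zero           _   v≢i = contradiction refl v≢i
twoVertices _                  (Fin.suc Fin.zero) (Fin.suc Fin.zero) _   v≢i = contradiction refl v≢i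
twoVertices Fin.zero           (Fin.suc Fin.zero) Fin.zero           _   _   = refl
twoVertices (Fin.suc Fin.zero) Fin.zero           (Fin.suc Fin.zero) _   _   = refl

singleton-fixingSet : (G : Graph 2) (i : Fin 2) → IsFixingSet G (λ v → v ≡ i)
singleton-fixingSet G i σ _ fixesI v with v ≟ i
... | yes v≡i = fixesI v v≡i
... | no v≢i  = fixesAllButOne⇒fixes σ v λ u u≢v → fixesI u (twoVertices u v i u≢v v≢i)

twoVertices-fixaticNumber : (G : Graph 2) → IsFixaticNumber G 2
twoVertices-fixaticNumber G =
  ((λ v → v) , (λ i → i , refl) , singleton-fixingSet G) ,
  λ k c fixatic → classes≤order c (proj₁ fixatic)

fixaticSum-bounds : ∀ {n} (G : Graph (suc n)) →
                    Σ ℕ λ a → Σ ℕ λ b →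
                      IsFixaticNumber G a × IsFixaticNumber (complement G) b ×
                      2 ≤ a + b × a + b ≤ 2 * suc n
fixaticSum-bounds {n} G with fixaticNumber G
... | a , isNumber , 1≤a , a≤1+n =
  a , a , isNumber , fixaticNumber-complement G isNumber ,
  +-mono-≤ 1≤a 1≤a , +-mono-≤ a≤1+n (subst (a ≤_) (sym (+-identityʳ (suc n))) a≤1+n)

mainTheorem20 :
    ((n : ℕ) → 2 ≤ n → (G : Graph n) → Connected G →
      Σ ℕ λ a → Σ ℕ λ b →
        IsFixaticNumber G a × IsFixaticNumber (complement G) b ×
        2 ≤ a + b × a + b ≤ 2 * n)
    ×
    (Σ ℕ λ n → Σ (Graph n) λ G → Σ ℕ λ a → Σ ℕ λ b →
      2 ≤ n × Connected G ×
      IsFixaticNumber G a × IsFixaticNumber (complement G) b × a + b ≡ 2)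
    ×
    (Σ ℕ λ n → Σ (Graph n) λ G → Σ ℕ λ a → Σ ℕ λ b →
      2 ≤ n × Connected G ×
      IsFixaticNumber G a × IsFixaticNumber (complement G) b × a + b ≡ 2 * n)
mainTheorem20 =
  (λ { (suc n) _ G _ → fixaticSum-bounds G }) ,
  (3 , complete 3 , 1 , 1 , s≤s (s≤s z≤n) , complete-connected ,
   K₃-fixaticNumber , fixaticNumber-complement (complete 3) K₃-fixaticNumber , refl) ,
  (2 , complete 2 , 2 , 2 , s≤s (s≤s z≤n) , complete-connected ,
   K₂-fixaticNumber , fixaticNumber-complement (complete 2) K₂-fixaticNumber , refl)
  where
  K₃-fixaticNumber : IsFixaticNumber (complete 3) 1
  K₃-fixaticNumber = fullySymmetric-fixaticNumber ≤-refl (complete 3) complete-automorphism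
  K₂-fixaticNumber : IsFixaticNumber (complete 2) 2
  K₂-fixaticNumber = twoVertices-fixaticNumber (complete 2)
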